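{- Let $k\ge1$ be the common defect of the elements of $J\setminus(J\cap D_1)$. Then both $2^{d-k}$ and $-2^{d-k}$ occur as inner products $(x_0j,x_0j')$ of distinct vectors $x_0j\neq x_0j'$ of the orbit $x_0J=\{x_0j:j\in J\}$.
   Context: Let $d\ge3$, $\Omega=\mathbb{F}_2^d$, $V=\mathbb{R}^{2^d}$ with orthonormal basis $(v_\omega)_{\omega\in\Omega}$, $x_0=\sum_\omega v_\omega$. For $A\subseteq\Omega$, $\varepsilon_A$ negates $v_\omega$ for $\omega\in A$ and fixes the others. Subsets of $\Omega$ are binary words (addition = symmetric difference); $RM(r,d)$ is the Reed–Muller code spanned by affine subspaces of $\Omega$ of codimension $r$. The defect of $A\in RM(2,d)$: $A$ is the support of a Boolean function $F$ of degree $\le2$, and the alternating form $B_F(u,w)=F(x+u+w)+F(x+u)+F(x+w)+F(x)$ (independent of $x$) has rank $2k$; $k$ is the defect of $A$ (and of $\varepsilon_A$). Let $D=\{\varepsilon_A:A\in RM(2,d)\}$, $D_1=\{\varepsilon_A:A\in RM(1,d)\}$. $P\cong AGL(d,2)$ acts on $V$ by permutation matrices $v_\omega\mapsto v_{\omega g}$ and normalizes $D$ and $D_1$. Let $m$ be an integer with $3\le m\le d$ such that $p=2^m-1$ is prime, let $g\in P$ have order $p$ and fix a point $\omega_0\in\Omega$. Let $J\le D$ be a $\langle g\rangle$-invariant subgroup such that $\omega_0\notin A$ for every $\varepsilon_A\in J$, $J\cap D_1=\{\varepsilon_A:A\in RM(1,d),\omega_0\notin A\}$ (order $2^d$), and $J/(J\cap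 D_1)$ is an irreducible $\mathbb{F}_2\langle g\rangle$-module of order $2^m$. All elements of $J\setminus(J\cap D_1)$ have the same defect $k\ge1$. -}

module Defs where

open import Data.Bool using (Bool; true; false; _xor_; _∧_; not; if_then_else_)
open import Data.Nat using (ℕ; zero; suc; _+_; _*_; _∸_; _^_; _≤_; _<_)
open import Data.Integer using (ℤ; +_; -_) renaming (_+_ to _+ℤ_; _*_ to _*ℤ_)
open import Data.Vec using (Vec; []; _∷_; replicate; zipWith)
open import Data.List using (List; []; _∷_; _++_; map; concatMap)
open import Data.Product using (Σ; _×_; ∃)
open import Relation.Binary.PropositionalEquality using (_≡_)

Ω : ℕ → Set
Ω d = Vec Bool d

Subset : ℕ → Set
Subset d = Ω d → Bool

_≐_ : ∀ {d} → Subset d → Subset d → Set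
A ≐ B = ∀ ω → A ω ≡ B ω

_⊕_ : ∀ {d} → Ω d → Ω d → Ω d
_⊕_ = zipWith _xor_

zeroΩ : ∀ d → Ω d
zeroΩ d = replicate d false

-- symmetric difference (group law of D: ε_A ε_B = ε_{A+B})
_△_ : ∀ {d} → Subset d → Subset d → Subset d
(A △ B) ω = A ω xor B ω

∅ : ∀ {d} → Subset d
∅ _ = false

allΩ : ∀ d → List (Ω d)
allΩ zero = [] ∷ []
allΩ (suc d) = map (true ∷_) (allΩ d) ++ map (false ∷_) (allΩ d)

-- enumeration of all subsets of Ω (up to pointwise equality)
allSubsets : ∀ d → List (Subset d)
allSubsets zero = (λ _ → true) ∷ (λ _ → false) ∷ []
allSubsets (suc d) =
  concatMap (λ f → map (λ h → pick f h) (allSubsets d)) (allSubsets d)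
  where
  pick : Subset d → Subset d → Subset (suc d)
  pick f h (true ∷ v) = f v
  pick f h (false ∷ v) = h v

countB : ∀ {a} {X : Set a} → (X → Bool) → List X → ℕ
countB P [] = 0
countB P (x ∷ xs) = (if P x then 1 else 0) + countB P xs

dot : ∀ {n} → Vec Bool n → Vec Bool n → Bool
dot [] [] = false
dot (x ∷ xs) (y ∷ ys) = (x ∧ y) xor dot xs ys

-- row vector times matrix (matrix given as list of n rows of length d)
vecMat : ∀ {n d} → Vec Bool n → Vec (Vec Bool d) n → Vec Bool d
vecMat {d = d} [] [] = replicate d false
vecMat (x ∷ xs) (r ∷ rs) = (if x then r else replicate _ false) ⊕ vecMat xs rs

Matrix : ℕ → Set
Matrix d = Vec (Vec Bool d) d

affineFun : ∀ {d} → Bool → Vec Bool d → Subset d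
affineFun c a ω = c xor dot a ω

quadFun : ∀ {d} → Bool → Vec Bool d → Matrix d → Subset d
quadFun c a B ω = c xor dot a ω xor dot (vecMat ω B) ω

RM1 : ∀ {d} → Subset d → Set
RM1 {d} A = Σ Bool λ c → Σ (Vec Bool d) λ a → A ≐ affineFun c a

RM2 : ∀ {d} → Subset d → Set
RM2 {d} A = Σ Bool λ c → Σ (Vec Bool d) λ a → Σ (Matrix d) λ B → A ≐ quadFun c a B

-- the alternating form B_F(u,w) = F(x+u+w)+F(x+u)+F(x+w)+F(x), taken at x = 0
formB : ∀ {d} → Subset d → Ω d → Ω d → Bool
formB {d} A u w = A (u ⊕ w) xor A u xor A w xor A (zeroΩ d)

allB : ∀ {a} {X : Set a} → (X → Bool) → List X → Bool
allB P [] = true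
allB P (x ∷ xs) = P x ∧ allB P xs

inRadical : ∀ {d} → Subset d → Ω d → Bool
inRadical {d} A u = allB (λ w → not (formB A u w)) (allΩ d)

-- rank(B_F) = d − dim rad(B_F); rank = 2k  ⇔  |rad| · 2^(2k) = 2^d
HasDefect : ∀ {d} → Subset d → ℕ → Set
HasDefect {d} A k = countB (inRadical A) (allΩ d) * 2 ^ (2 * k) ≡ 2 ^ d

affApply : ∀ {d} → Matrix d → Ω d → Ω d → Ω d
affApply M b ω = vecMat ω M ⊕ b

Invertible : ∀ {d} → Matrix d → Set
Invertible {d} M = Σ (Matrix d) λ N →
  (∀ (ω : Ω d) → vecMat (vecMat ω M) N ≡ ω) × (∀ (ω : Ω d) → vecMat (vecMat ω N) M ≡ ω)

iter : ∀ {a} {X : Set a} → ℕ → (X → X) → X → X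
iter zero f x = x
iter (suc n) f x = f (iter n f x)

-- the vectors x₀ε_A ∈ V = ℝ^Ω (entries ±1, so integer coordinates suffice)

x0ε : ∀ {d} → Subset d → Ω d → ℤ
x0ε A ω = if A ω then - (+ 1) else + 1

sumℤ : ∀ {a} {X : Set a} → (X → ℤ) → List X → ℤ
sumℤ f [] = + 0
sumℤ f (x ∷ xs) = f x +ℤ sumℤ f xs

inner : ∀ {d} → (Ω d → ℤ) → (Ω d → ℤ) → ℤ
inner {d} x y = sumℤ (λ ω → x ω *ℤ y ω) (allΩ d)

_≐'_ : ∀ {d} {Y : Set} → (Ω d → Y) → (Ω d → Y) → Set
f ≐' g = ∀ ω → f ω ≡ g ω

module Submission where

-- Take A ∈ J not affine: it exists because J has 2^(m+d) > 2^d elements, while only 2^d affine sets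
-- avoid ω₀.  For u ∈ Ω let A_u = A + L_u with L_u(x) = u·(x + ω₀), so that ε_{A_u} ∈ J and
-- (x₀, x₀ε_{A_u}) = Σ_x (−1)^{A_u(x)} =: W(u).  Substituting x ↦ x + y in W(u)² leaves
-- Σ_y (−1)^{A(y)+A(0)+u·y} Σ_x (−1)^{B_A(y,x)}, whose inner sum is 2^d on rad B_A and 0 off it; hence
-- W(u)² is 0 or 2^d·|rad B_A| = 4^(d−k), i.e. W(u) ∈ {0, ±2^(d−k)}.  Orthogonality of characters gives
-- Σ_u W(u)² = 4^d and, as ω₀ ∉ A, Σ_u W(u) = 2^d.  Were +2^(d−k) never attained, 4^d = −2^(d−k)·2^d;
-- were −2^(d−k) never attained, 4^d = 2^(d−k)·2^d, contradicting k ≥ 1.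

open import Defs
open import Data.Bool using (Bool; true; false; _xor_; _∧_; not; if_then_else_) renaming (_≟_ to _≟ᵇ_)
open import Data.Bool.Properties
  using (¬-not; not-involutive; ∧-comm; xor-comm; xor-assoc; xor-identityˡ; xor-identityʳ; xor-same; xor-∧-commutativeRing)
open import Data.Nat using (ℕ; zero; suc; z≤n; s≤s; _≤_; _<_; _∸_; _^_; _*_; ≢-nonZero) renaming (_+_ to _ℕ+_)
import Data.Nat.Properties as ℕ
open import Data.Nat.Primality using (Prime)
open import Data.Nat.Tactic.RingSolver using () renaming (solve-∀ to ℕ-solve-∀)
open import Data.Integer using (ℤ; +_; -_; ∣_∣) renaming (_+_ to _+ℤ_; _*_ to _*ℤ_)
import Data.Integer.Properties as ℤ
open import Data.Fin using (Fin; zero; suc)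
open import Data.Fin.Properties using (injective⇒≤)
open import Data.Vec using (Vec; []; _∷_; replicate)
open import Data.Vec.Properties using (zipWith-comm; zipWith-assoc; zipWith-identityˡ; zipWith-identityʳ)
open import Data.List using (List; []; _∷_; _++_; map; length; lookup; filter; concatMap; cartesianProductWith)
open import Data.List.Properties using (length-++; length-map)
open import Data.List.Relation.Unary.All as All using (All; []; _∷_)
import Data.List.Relation.Unary.All.Properties as All
open import Data.List.Relation.Unary.All.Properties.Core using (¬Any⇒All¬)
open import Data.List.Relation.Unary.Any as Any using (Any; here; there; any?)
import Data.List.Relation.Unary.Any.Properties as Any
open import Data.List.Relation.Unary.AllPairs using ([]; _∷_)
open import Data.List.Relation.Unary.Unique.Setoid using (Unique)
import Data.List.Relation.Unary.Unique.Setoid.Properties as Unique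
open import Data.List.Membership.Propositional using (_∈_; lose)
open import Data.List.Membership.Propositional.Properties using (∈-map⁺; ∈-++⁺ˡ; ∈-++⁺ʳ; ∈-lookup)
import Data.List.Membership.Setoid as SetoidMembership
open import Data.List.Membership.Setoid.Properties using (index-injective)
open import Data.Product using (Σ; ∃; _×_; _,_)
open import Data.Sum using (_⊎_; inj₁; inj₂; [_,_]′)
open import Data.Empty using (⊥-elim)
open import Function using (id; case_of_)
open import Level using (0ℓ)
open import Relation.Nullary using (¬_; Dec; yes; no)
open import Relation.Nullary.Decidable using (_×-dec_; ¬?; decidable-stable)
import Relation.Nullary.Decidable as Dec
open import Relation.Unary using (Decidable)
open import Relation.Binary.Bundles using (Setoid)
open import Relation.Binary.Definitions using (tri<; tri≈; tri>)
open import Relation.Binary.PropositionalEquality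
  using (_≡_; _≢_; refl; sym; trans; cong; cong₂; subst; _→-setoid_; module ≡-Reasoning)
open import Algebra.Properties.CommutativeSemigroup ℤ.+-commutativeSemigroup using () renaming (interchange to +-interchange)
open import Algebra.Solver.Ring.AlmostCommutativeRing using (fromCommutativeRing)
import Algebra.Solver.Ring.Simple as RingSolver

open RingSolver (fromCommutativeRing xor-∧-commutativeRing) _≟ᵇ_ using (solve; _:=_; _:+_; _:*_; con)
open ≡-Reasoning

xor-interchange : ∀ p q r t → (p xor q) xor (r xor t) ≡ (p xor r) xor (q xor t)
xor-interchange = solve 4 (λ p q r t → (p :+ q) :+ (r :+ t) := (p :+ r) :+ (q :+ t)) refl

xor≡false⇒≡ : ∀ a b → a xor b ≡ false → a ≡ b
xor≡false⇒≡ true true _ = refl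
xor≡false⇒≡ false false _ = refl

⊕-comm : ∀ {d} (x y : Ω d) → x ⊕ y ≡ y ⊕ x
⊕-comm = zipWith-comm xor-comm

⊕-assoc : ∀ {d} (x y z : Ω d) → (x ⊕ y) ⊕ z ≡ x ⊕ (y ⊕ z)
⊕-assoc = zipWith-assoc xor-assoc

⊕-identityˡ : ∀ {d} (x : Ω d) → zeroΩ d ⊕ x ≡ x
⊕-identityˡ = zipWith-identityˡ xor-identityˡ

⊕-identityʳ : ∀ {d} (x : Ω d) → x ⊕ zeroΩ d ≡ x
⊕-identityʳ = zipWith-identityʳ xor-identityʳ

⊕-self : ∀ {d} (x : Ω d) → x ⊕ x ≡ zeroΩ d
⊕-self [] = refl
⊕-self (b ∷ x) = cong₂ _∷_ (xor-same b) (⊕-self x)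

⊕-cancelʳ : ∀ {d} (x t : Ω d) → (x ⊕ t) ⊕ t ≡ x
⊕-cancelʳ x t = begin
  (x ⊕ t) ⊕ t     ≡⟨ ⊕-assoc x t t ⟩
  x ⊕ (t ⊕ t)     ≡⟨ cong (x ⊕_) (⊕-self t) ⟩
  x ⊕ zeroΩ _     ≡⟨ ⊕-identityʳ x ⟩
  x               ∎

dot-comm : ∀ {d} (x y : Ω d) → dot x y ≡ dot y x
dot-comm [] [] = refl
dot-comm (a ∷ x) (b ∷ y) = cong₂ _xor_ (∧-comm a b) (dot-comm x y)

dot-distribˡ : ∀ {d} (x y z : Ω d) → dot (x ⊕ y) z ≡ dot x z xor dot y z
dot-distribˡ [] [] [] = refl
dot-distribˡ (a ∷ x) (b ∷ y) (c ∷ z) = begin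
  ((a xor b) ∧ c) xor dot (x ⊕ y) z            ≡⟨ cong (((a xor b) ∧ c) xor_) (dot-distribˡ x y z) ⟩
  ((a xor b) ∧ c) xor (dot x z xor dot y z)    ≡⟨ regroup a b c (dot x z) (dot y z) ⟩
  ((a ∧ c) xor dot x z) xor ((b ∧ c) xor dot y z) ∎
  where
  regroup : ∀ a b c p q → ((a xor b) ∧ c) xor (p xor q) ≡ ((a ∧ c) xor p) xor ((b ∧ c) xor q)
  regroup = solve 5 (λ a b c p q → ((a :+ b) :* c) :+ (p :+ q) := ((a :* c) :+ p) :+ ((b :* c) :+ q)) refl

dot-distribʳ : ∀ {d} (z x y : Ω d) → dot z (x ⊕ y) ≡ dot z x xor dot z y
dot-distribʳ z x y = begin
  dot z (x ⊕ y)          ≡⟨ dot-comm z (x ⊕ y) ⟩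
  dot (x ⊕ y) z          ≡⟨ dot-distribˡ x y z ⟩
  dot x z xor dot y z    ≡⟨ cong₂ _xor_ (dot-comm x z) (dot-comm y z) ⟩
  dot z x xor dot z y    ∎

dot-zeroˡ : ∀ {d} (x : Ω d) → dot (zeroΩ d) x ≡ false
dot-zeroˡ [] = refl
dot-zeroˡ (_ ∷ x) = dot-zeroˡ x

dot-zeroʳ : ∀ {d} (x : Ω d) → dot x (zeroΩ d) ≡ false
dot-zeroʳ x = trans (dot-comm x _) (dot-zeroˡ x)

⊕-interchange : ∀ {d} (p q r t : Ω d) → (p ⊕ q) ⊕ (r ⊕ t) ≡ (p ⊕ r) ⊕ (q ⊕ t)
⊕-interchange [] [] [] [] = refl
⊕-interchange (a ∷ p) (b ∷ q) (c ∷ r) (e ∷ t) = cong₂ _∷_ (xor-interchange a b c e) (⊕-interchange p q r t)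

vecMat-distrib : ∀ {n d} (x y : Vec Bool n) (B : Vec (Ω d) n) → vecMat (x ⊕ y) B ≡ vecMat x B ⊕ vecMat y B
vecMat-distrib [] [] [] = sym (⊕-identityˡ _)
vecMat-distrib (a ∷ x) (b ∷ y) (r ∷ B) = begin
  row (a xor b) ⊕ vecMat (x ⊕ y) B                 ≡⟨ cong₂ _⊕_ (row-xor a b) (vecMat-distrib x y B) ⟩
  (row a ⊕ row b) ⊕ (vecMat x B ⊕ vecMat y B)      ≡⟨ ⊕-interchange (row a) (row b) (vecMat x B) (vecMat y B) ⟩
  (row a ⊕ vecMat x B) ⊕ (row b ⊕ vecMat y B)      ∎
  where
  row : Bool → Ω _
  row c = if c then r else replicate _ false
  row-xor : ∀ a b → row (a xor b) ≡ row a ⊕ row b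
  row-xor true true = sym (⊕-self r)
  row-xor true false = sym (⊕-identityʳ r)
  row-xor false b = sym (⊕-identityˡ (row b))

vecMat-zero : ∀ {n d} (B : Vec (Ω d) n) → vecMat (zeroΩ n) B ≡ zeroΩ d
vecMat-zero [] = refl
vecMat-zero (r ∷ B) = trans (⊕-identityˡ _) (vecMat-zero B)

module _ {X : Set} where

  sumℤ-cong : ∀ {f g : X → ℤ} (xs : List X) → (∀ x → f x ≡ g x) → sumℤ f xs ≡ sumℤ g xs
  sumℤ-cong [] f≗g = refl
  sumℤ-cong (x ∷ xs) f≗g = cong₂ _+ℤ_ (f≗g x) (sumℤ-cong xs f≗g)

  sumℤ-++ : ∀ (f : X → ℤ) (xs ys : List X) → sumℤ f (xs ++ ys) ≡ sumℤ f xs +ℤ sumℤ f ys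
  sumℤ-++ f [] ys = sym (ℤ.+-identityˡ _)
  sumℤ-++ f (x ∷ xs) ys = trans (cong (f x +ℤ_) (sumℤ-++ f xs ys)) (sym (ℤ.+-assoc (f x) _ _))

  sumℤ-distrib-+ : ∀ (f g : X → ℤ) (xs : List X) → sumℤ (λ x → f x +ℤ g x) xs ≡ sumℤ f xs +ℤ sumℤ g xs
  sumℤ-distrib-+ f g [] = refl
  sumℤ-distrib-+ f g (x ∷ xs) = begin
    (f x +ℤ g x) +ℤ sumℤ (λ x → f x +ℤ g x) xs      ≡⟨ cong ((f x +ℤ g x) +ℤ_) (sumℤ-distrib-+ f g xs) ⟩
    (f x +ℤ g x) +ℤ (sumℤ f xs +ℤ sumℤ g xs)         ≡⟨ +-interchange (f x) (g x) (sumℤ f xs) (sumℤ g xs) ⟩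
    (f x +ℤ sumℤ f xs) +ℤ (g x +ℤ sumℤ g xs)         ∎

  sumℤ-*ˡ : ∀ (c : ℤ) (f : X → ℤ) (xs : List X) → sumℤ (λ x → c *ℤ f x) xs ≡ c *ℤ sumℤ f xs
  sumℤ-*ˡ c f [] = sym (ℤ.*-zeroʳ c)
  sumℤ-*ˡ c f (x ∷ xs) = trans (cong (c *ℤ f x +ℤ_) (sumℤ-*ˡ c f xs)) (sym (ℤ.*-distribˡ-+ c (f x) _))

  sumℤ-*ʳ : ∀ (c : ℤ) (f : X → ℤ) (xs : List X) → sumℤ (λ x → f x *ℤ c) xs ≡ sumℤ f xs *ℤ c
  sumℤ-*ʳ c f xs = begin
    sumℤ (λ x → f x *ℤ c) xs    ≡⟨ sumℤ-cong xs (λ x → ℤ.*-comm (f x) c) ⟩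
    sumℤ (λ x → c *ℤ f x) xs    ≡⟨ sumℤ-*ˡ c f xs ⟩
    c *ℤ sumℤ f xs              ≡⟨ ℤ.*-comm c (sumℤ f xs) ⟩
    sumℤ f xs *ℤ c              ∎

  sumℤ-neg : ∀ (f : X → ℤ) (xs : List X) → sumℤ (λ x → - f x) xs ≡ - sumℤ f xs
  sumℤ-neg f [] = refl
  sumℤ-neg f (x ∷ xs) = trans (cong (- f x +ℤ_) (sumℤ-neg f xs)) (sym (ℤ.neg-distrib-+ (f x) _))

  sumℤ-zero : ∀ (xs : List X) → sumℤ (λ _ → + 0) xs ≡ + 0
  sumℤ-zero [] = refl
  sumℤ-zero (x ∷ xs) = trans (ℤ.+-identityˡ _) (sumℤ-zero xs)

  sumℤ-countB : ∀ (P : X → Bool) (xs : List X) → sumℤ (λ x → if P x then + 1 else + 0) xs ≡ + countB P xs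
  sumℤ-countB P [] = refl
  sumℤ-countB P (x ∷ xs) with P x
  ... | true = cong (+ 1 +ℤ_) (sumℤ-countB P xs)
  ... | false = trans (ℤ.+-identityˡ _) (sumℤ-countB P xs)

sumℤ-map : ∀ {X Y : Set} (f : Y → ℤ) (h : X → Y) (xs : List X) → sumℤ f (map h xs) ≡ sumℤ (λ x → f (h x)) xs
sumℤ-map f h [] = refl
sumℤ-map f h (x ∷ xs) = cong (f (h x) +ℤ_) (sumℤ-map f h xs)

sumℤ-swap : ∀ {X Y : Set} (f : X → Y → ℤ) (xs : List X) (ys : List Y) →
  sumℤ (λ x → sumℤ (f x) ys) xs ≡ sumℤ (λ y → sumℤ (λ x → f x y) xs) ys
sumℤ-swap f [] ys = sym (sumℤ-zero ys)
sumℤ-swap f (x ∷ xs) ys = begin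
  sumℤ (f x) ys +ℤ sumℤ (λ x → sumℤ (f x) ys) xs            ≡⟨ cong (sumℤ (f x) ys +ℤ_) (sumℤ-swap f xs ys) ⟩
  sumℤ (f x) ys +ℤ sumℤ (λ y → sumℤ (λ x → f x y) xs) ys    ≡⟨ sym (sumℤ-distrib-+ (f x) _ ys) ⟩
  sumℤ (λ y → f x y +ℤ sumℤ (λ x → f x y) xs) ys            ∎

sign : Bool → ℤ
sign b = if b then - + 1 else + 1

sign-xor : ∀ a b → sign (a xor b) ≡ sign a *ℤ sign b
sign-xor true true = refl
sign-xor true false = refl
sign-xor false true = refl
sign-xor false false = refl

sign-not : ∀ a → sign (not a) ≡ - sign a
sign-not true = refl
sign-not false = refl

sign-xor-true : ∀ b → sign (b xor true) ≡ - sign b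
sign-xor-true true = refl
sign-xor-true false = refl

+2^suc : ∀ d → + (2 ^ suc d) ≡ + (2 ^ d) +ℤ + (2 ^ d)
+2^suc d = trans (cong (λ n → + (2 ^ d ℕ+ n)) (ℕ.+-identityʳ (2 ^ d))) (ℤ.pos-+ (2 ^ d) (2 ^ d))

ΣΩ : ∀ d → (Ω d → ℤ) → ℤ
ΣΩ d f = sumℤ f (allΩ d)

ΣΩ-cong : ∀ d {f g : Ω d → ℤ} → (∀ x → f x ≡ g x) → ΣΩ d f ≡ ΣΩ d g
ΣΩ-cong d = sumℤ-cong (allΩ d)

ΣΩ-split : ∀ d (f : Ω (suc d) → ℤ) → ΣΩ (suc d) f ≡ ΣΩ d (λ x → f (true ∷ x)) +ℤ ΣΩ d (λ x → f (false ∷ x))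
ΣΩ-split d f = trans (sumℤ-++ f (map (true ∷_) (allΩ d)) (map (false ∷_) (allΩ d)))
  (cong₂ _+ℤ_ (sumℤ-map f (true ∷_) (allΩ d)) (sumℤ-map f (false ∷_) (allΩ d)))

ΣΩ-one : ∀ d → ΣΩ d (λ _ → + 1) ≡ + (2 ^ d)
ΣΩ-one zero = refl
ΣΩ-one (suc d) = trans (ΣΩ-split d (λ _ → + 1)) (trans (cong₂ _+ℤ_ (ΣΩ-one d) (ΣΩ-one d)) (sym (+2^suc d)))

ΣΩ-translate : ∀ d (f : Ω d → ℤ) (t : Ω d) → ΣΩ d f ≡ ΣΩ d (λ x → f (x ⊕ t))
ΣΩ-translate zero f [] = refl
ΣΩ-translate (suc d) f (b ∷ t) = begin
  ΣΩ (suc d) f                                                        ≡⟨ ΣΩ-split d f ⟩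
  ΣΩ d (λ x → f (true ∷ x)) +ℤ ΣΩ d (λ x → f (false ∷ x))
    ≡⟨ cong₂ _+ℤ_ (ΣΩ-translate d (λ x → f (true ∷ x)) t) (ΣΩ-translate d (λ x → f (false ∷ x)) t) ⟩
  ΣΩ d (λ x → f (true ∷ (x ⊕ t))) +ℤ ΣΩ d (λ x → f (false ∷ (x ⊕ t))) ≡⟨ halves b ⟩
  ΣΩ d (λ x → f (not b ∷ (x ⊕ t))) +ℤ ΣΩ d (λ x → f (b ∷ (x ⊕ t)))   ≡⟨ sym (ΣΩ-split d (λ x → f (x ⊕ (b ∷ t)))) ⟩
  ΣΩ (suc d) (λ x → f (x ⊕ (b ∷ t)))                                  ∎
  where
  halves : ∀ b → ΣΩ d (λ x → f (true ∷ (x ⊕ t))) +ℤ ΣΩ d (λ x → f (false ∷ (x ⊕ t)))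
               ≡ ΣΩ d (λ x → f (not b ∷ (x ⊕ t))) +ℤ ΣΩ d (λ x → f (b ∷ (x ⊕ t)))
  halves true = ℤ.+-comm (ΣΩ d (λ x → f (true ∷ (x ⊕ t)))) (ΣΩ d (λ x → f (false ∷ (x ⊕ t))))
  halves false = refl

i≡-i⇒i≡0 : ∀ (i : ℤ) → i ≡ - i → i ≡ + 0
i≡-i⇒i≡0 (+ zero) _ = refl

ΣΩ-antiperiodic : ∀ d (f : Ω d → ℤ) (t : Ω d) → (∀ x → f (x ⊕ t) ≡ - f x) → ΣΩ d f ≡ + 0
ΣΩ-antiperiodic d f t f-anti = i≡-i⇒i≡0 _ (begin
  ΣΩ d f                    ≡⟨ ΣΩ-translate d f t ⟩
  ΣΩ d (λ x → f (x ⊕ t))    ≡⟨ ΣΩ-cong d f-anti ⟩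
  ΣΩ d (λ x → - f x)        ≡⟨ sumℤ-neg f (allΩ d) ⟩
  - ΣΩ d f                  ∎)

characterSum : ∀ d → Ω d → ℤ
characterSum d x = ΣΩ d (λ u → sign (dot u x))

characterSum-true∷ : ∀ d x → characterSum (suc d) (true ∷ x) ≡ + 0
characterSum-true∷ d x = begin
  characterSum (suc d) (true ∷ x)                         ≡⟨ ΣΩ-split d (λ u → sign (dot u (true ∷ x))) ⟩
  ΣΩ d (λ u → sign (not (dot u x))) +ℤ characterSum d x   ≡⟨ cong (_+ℤ characterSum d x) negated ⟩
  - characterSum d x +ℤ characterSum d x                  ≡⟨ ℤ.+-inverseˡ (characterSum d x) ⟩
  + 0                                                     ∎
  where
  negated : ΣΩ d (λ u → sign (not (dot u x))) ≡ - characterSum d x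
  negated = trans (ΣΩ-cong d (λ u → sign-not (dot u x))) (sumℤ-neg _ (allΩ d))

ΣΩ-sift : ∀ d (g : Ω d → ℤ) → ΣΩ d (λ x → g x *ℤ characterSum d x) ≡ + (2 ^ d) *ℤ g (zeroΩ d)
ΣΩ-sift zero g = trans (ℤ.+-identityʳ _) (trans (ℤ.*-identityʳ (g [])) (sym (ℤ.*-identityˡ (g []))))
ΣΩ-sift (suc d) g = begin
  ΣΩ (suc d) (λ x → g x *ℤ characterSum (suc d) x)        ≡⟨ ΣΩ-split d _ ⟩
  ΣΩ d (λ x → g (true ∷ x) *ℤ characterSum (suc d) (true ∷ x)) +ℤ S′
    ≡⟨ cong (_+ℤ S′) (trans (ΣΩ-cong d vanish) (sumℤ-zero (allΩ d))) ⟩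
  + 0 +ℤ S′                                              ≡⟨ ℤ.+-identityˡ S′ ⟩
  S′                                                     ≡⟨ trans (ΣΩ-cong d double) (sumℤ-distrib-+ _ _ (allΩ d)) ⟩
  S +ℤ S                                                 ≡⟨ cong₂ _+ℤ_ (ΣΩ-sift d g₀) (ΣΩ-sift d g₀) ⟩
  + (2 ^ d) *ℤ g₀ (zeroΩ d) +ℤ + (2 ^ d) *ℤ g₀ (zeroΩ d)  ≡⟨ sym (ℤ.*-distribʳ-+ (g₀ (zeroΩ d)) (+ (2 ^ d)) (+ (2 ^ d))) ⟩
  (+ (2 ^ d) +ℤ + (2 ^ d)) *ℤ g₀ (zeroΩ d)                ≡⟨ cong (_*ℤ g₀ (zeroΩ d)) (sym (+2^suc d)) ⟩
  + (2 ^ suc d) *ℤ g (zeroΩ (suc d))                      ∎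
  where
  g₀ : Ω d → ℤ
  g₀ x = g (false ∷ x)
  S S′ : ℤ
  S = ΣΩ d (λ x → g₀ x *ℤ characterSum d x)
  S′ = ΣΩ d (λ x → g₀ x *ℤ characterSum (suc d) (false ∷ x))
  vanish : ∀ x → g (true ∷ x) *ℤ characterSum (suc d) (true ∷ x) ≡ + 0
  vanish x = trans (cong (g (true ∷ x) *ℤ_) (characterSum-true∷ d x)) (ℤ.*-zeroʳ (g (true ∷ x)))
  double : ∀ x → g₀ x *ℤ characterSum (suc d) (false ∷ x) ≡ g₀ x *ℤ characterSum d x +ℤ g₀ x *ℤ characterSum d x
  double x = trans (cong (g₀ x *ℤ_) (ΣΩ-split d (λ u → sign (dot u (false ∷ x)))))
                   (ℤ.*-distribˡ-+ (g₀ x) (characterSum d x) (characterSum d x))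

allΩ-complete : ∀ d (ω : Ω d) → ω ∈ allΩ d
allΩ-complete zero [] = here refl
allΩ-complete (suc d) (true ∷ ω) = ∈-++⁺ˡ (∈-map⁺ (true ∷_) (allΩ-complete d ω))
allΩ-complete (suc d) (false ∷ ω) = ∈-++⁺ʳ (map (true ∷_) (allΩ d)) (∈-map⁺ (false ∷_) (allΩ-complete d ω))

length-allΩ : ∀ d → length (allΩ d) ≡ 2 ^ d
length-allΩ zero = refl
length-allΩ (suc d) = begin
  length (map (true ∷_) (allΩ d) ++ map (false ∷_) (allΩ d))          ≡⟨ length-++ (map (true ∷_) (allΩ d)) ⟩
  length (map (true ∷_) (allΩ d)) ℕ+ length (map (false ∷_) (allΩ d)) ≡⟨ cong₂ _ℕ+_ (length-map _ (allΩ d)) (length-map _ (allΩ d)) ⟩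
  length (allΩ d) ℕ+ length (allΩ d)                                  ≡⟨ cong (λ n → n ℕ+ n) (length-allΩ d) ⟩
  2 ^ d ℕ+ 2 ^ d                                                      ≡⟨ cong (2 ^ d ℕ+_) (sym (ℕ.+-identityʳ (2 ^ d))) ⟩
  2 ^ suc d                                                           ∎

∃Ω? : ∀ {d} {P : Ω d → Set} → Decidable P → Dec (∃ P)
∃Ω? {d} P? with any? P? (allΩ d)
... | yes some = yes (Any.satisfied some)
... | no none = no (λ (ω , Pω) → none (lose (allΩ-complete d ω) Pω))

countB-cong : ∀ {X : Set} {P Q : X → Bool} (xs : List X) → (∀ x → P x ≡ Q x) → countB P xs ≡ countB Q xs
countB-cong [] P≗Q = refl
countB-cong (x ∷ xs) P≗Q = cong₂ (λ b n → (if b then 1 else 0) ℕ+ n) (P≗Q x) (countB-cong xs P≗Q)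

allB-cong : ∀ {X : Set} {P Q : X → Bool} (xs : List X) → (∀ x → P x ≡ Q x) → allB P xs ≡ allB Q xs
allB-cong [] P≗Q = refl
allB-cong (x ∷ xs) P≗Q = cong₂ _∧_ (P≗Q x) (allB-cong xs P≗Q)

allB-true : ∀ {X : Set} (P : X → Bool) (xs : List X) → allB P xs ≡ true → All (λ x → P x ≡ true) xs
allB-true P [] _ = []
allB-true P (x ∷ xs) all with P x in Px
... | true = Px ∷ allB-true P xs all

allB-false : ∀ {X : Set} (P : X → Bool) (xs : List X) → allB P xs ≡ false → Any (λ x → P x ≡ false) xs
allB-false P (x ∷ xs) notAll with P x in Px
... | true = there (allB-false P xs notAll)
... | false = here Px

allBΩ-true : ∀ {d} (P : Ω d → Bool) → allB P (allΩ d) ≡ true → ∀ ω → P ω ≡ true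
allBΩ-true {d} P all ω = All.lookup (allB-true P (allΩ d) all) (allΩ-complete d ω)

-- Bilinearity of B_A (symmetry is automatic) is the only use made of deg A ≤ 2.
FormLinear : ∀ {d} → Subset d → Set
FormLinear A = ∀ x y v → formB A (x ⊕ y) v ≡ formB A x v xor formB A y v

formB-sym : ∀ {d} (A : Subset d) u w → formB A u w ≡ formB A w u
formB-sym {d} A u w = begin
  A (u ⊕ w) xor (A u xor (A w xor A0))    ≡⟨ cong (λ z → A z xor (A u xor (A w xor A0))) (⊕-comm u w) ⟩
  A (w ⊕ u) xor (A u xor (A w xor A0))    ≡⟨ swap (A (w ⊕ u)) (A u) (A w) A0 ⟩
  A (w ⊕ u) xor (A w xor (A u xor A0))    ∎
  where
  A0 : Bool
  A0 = A (zeroΩ d)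
  swap : ∀ p q r t → p xor (q xor (r xor t)) ≡ p xor (r xor (q xor t))
  swap = solve 4 (λ p q r t → p :+ (q :+ (r :+ t)) := p :+ (r :+ (q :+ t))) refl

formB-zeroˡ : ∀ {d} (A : Subset d) w → formB A (zeroΩ d) w ≡ false
formB-zeroˡ {d} A w = begin
  A (zeroΩ d ⊕ w) xor (A (zeroΩ d) xor (A w xor A (zeroΩ d)))
    ≡⟨ cong (λ z → A z xor (A (zeroΩ d) xor (A w xor A (zeroΩ d)))) (⊕-identityˡ w) ⟩
  A w xor (A (zeroΩ d) xor (A w xor A (zeroΩ d)))              ≡⟨ cancel (A w) (A (zeroΩ d)) ⟩
  false                                                        ∎
  where
  cancel : ∀ p q → p xor (q xor (p xor q)) ≡ false
  cancel = solve 2 (λ p q → p :+ (q :+ (p :+ q)) := con false) refl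

⊕-via-formB : ∀ {d} (A : Subset d) y x → A (y ⊕ x) ≡ A y xor (A x xor (A (zeroΩ d) xor formB A y x))
⊕-via-formB {d} A y x = unfold (A (y ⊕ x)) (A y) (A x) (A (zeroΩ d))
  where
  unfold : ∀ p q r t → p ≡ q xor (r xor (t xor (p xor (q xor (r xor t)))))
  unfold = solve 4 (λ p q r t → p := q :+ (r :+ (t :+ (p :+ (q :+ (r :+ t)))))) refl

FormLinear⇒linearʳ : ∀ {d} (A : Subset d) → FormLinear A → ∀ v x y → formB A v (x ⊕ y) ≡ formB A v x xor formB A v y
FormLinear⇒linearʳ A linear v x y = begin
  formB A v (x ⊕ y)              ≡⟨ formB-sym A v (x ⊕ y) ⟩
  formB A (x ⊕ y) v              ≡⟨ linear x y v ⟩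
  formB A x v xor formB A y v    ≡⟨ cong₂ _xor_ (formB-sym A x v) (formB-sym A y v) ⟩
  formB A v x xor formB A v y    ∎

formB-△ : ∀ {d} (A B : Subset d) u w → formB (A △ B) u w ≡ formB A u w xor formB B u w
formB-△ {d} A B u w = regroup (A (u ⊕ w)) (A u) (A w) (A (zeroΩ d)) (B (u ⊕ w)) (B u) (B w) (B (zeroΩ d))
  where
  regroup : ∀ p q r t p′ q′ r′ t′ →
    (p xor p′) xor ((q xor q′) xor ((r xor r′) xor (t xor t′))) ≡ (p xor (q xor (r xor t))) xor (p′ xor (q′ xor (r′ xor t′)))
  regroup = solve 8 (λ p q r t p′ q′ r′ t′ →
    (p :+ p′) :+ ((q :+ q′) :+ ((r :+ r′) :+ (t :+ t′))) := (p :+ (q :+ (r :+ t))) :+ (p′ :+ (q′ :+ (r′ :+ t′)))) refl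

formB-affineFun : ∀ {d} c (a : Ω d) u w → formB (affineFun c a) u w ≡ false
formB-affineFun {d} c a u w = begin
  (c xor dot a (u ⊕ w)) xor ((c xor dot a u) xor ((c xor dot a w) xor (c xor dot a (zeroΩ d))))
    ≡⟨ cong₂ (λ p q → (c xor p) xor ((c xor dot a u) xor ((c xor dot a w) xor (c xor q)))) (dot-distribʳ a u w) (dot-zeroʳ a) ⟩
  (c xor (dot a u xor dot a w)) xor ((c xor dot a u) xor ((c xor dot a w) xor (c xor false)))
    ≡⟨ cancel c (dot a u) (dot a w) ⟩
  false ∎
  where
  cancel : ∀ c x y → (c xor (x xor y)) xor ((c xor x) xor ((c xor y) xor (c xor false))) ≡ false
  cancel = solve 3 (λ c x y → (c :+ (x :+ y)) :+ ((c :+ x) :+ ((c :+ y) :+ (c :+ con false))) := con false) refl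

formB-△-affine : ∀ {d} (A : Subset d) c a u w → formB (A △ affineFun c a) u w ≡ formB A u w
formB-△-affine A c a u w = begin
  formB (A △ affineFun c a) u w                   ≡⟨ formB-△ A (affineFun c a) u w ⟩
  formB A u w xor formB (affineFun c a) u w       ≡⟨ cong (formB A u w xor_) (formB-affineFun c a u w) ⟩
  formB A u w xor false                           ≡⟨ xor-identityʳ (formB A u w) ⟩
  formB A u w                                     ∎

formB-cong : ∀ {d} {A A′ : Subset d} → A ≐ A′ → ∀ u w → formB A u w ≡ formB A′ u w
formB-cong {d} A≐A′ u w = cong₂ _xor_ (A≐A′ (u ⊕ w)) (cong₂ _xor_ (A≐A′ u) (cong₂ _xor_ (A≐A′ w) (A≐A′ (zeroΩ d))))

quadFun-formB : ∀ {d} c a (B : Matrix d) u w → formB (quadFun c a B) u w ≡ dot (vecMat u B) w xor dot (vecMat w B) u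
quadFun-formB {d} c a B u w = begin
  Q (u ⊕ w) xor (Q u xor (Q w xor Q (zeroΩ d)))
    ≡⟨ cong₂ (λ p q → p xor (Q u xor (Q w xor q))) expand-⊕ expand-zero ⟩
  (c xor ((au xor aw) xor ((uBu xor uBw) xor (wBu xor wBw)))) xor ((c xor (au xor uBu)) xor ((c xor (aw xor wBw)) xor (c xor (false xor false))))
    ≡⟨ cancel c au aw uBu uBw wBu wBw ⟩
  uBw xor wBu ∎
  where
  Q : Subset d
  Q = quadFun c a B
  au aw uBu uBw wBu wBw : Bool
  au = dot a u
  aw = dot a w
  uBu = dot (vecMat u B) u
  uBw = dot (vecMat u B) w
  wBu = dot (vecMat w B) u
  wBw = dot (vecMat w B) w
  expand-⊕ : Q (u ⊕ w) ≡ c xor ((au xor aw) xor ((uBu xor uBw) xor (wBu xor wBw)))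
  expand-⊕ = begin
    c xor (dot a (u ⊕ w) xor dot (vecMat (u ⊕ w) B) (u ⊕ w))
      ≡⟨ cong₂ (λ p q → c xor (p xor dot q (u ⊕ w))) (dot-distribʳ a u w) (vecMat-distrib u w B) ⟩
    c xor ((au xor aw) xor dot (vecMat u B ⊕ vecMat w B) (u ⊕ w))
      ≡⟨ cong (λ p → c xor ((au xor aw) xor p)) (dot-distribˡ (vecMat u B) (vecMat w B) (u ⊕ w)) ⟩
    c xor ((au xor aw) xor (dot (vecMat u B) (u ⊕ w) xor dot (vecMat w B) (u ⊕ w)))
      ≡⟨ cong₂ (λ p q → c xor ((au xor aw) xor (p xor q))) (dot-distribʳ (vecMat u B) u w) (dot-distribʳ (vecMat w B) u w) ⟩
    c xor ((au xor aw) xor ((uBu xor uBw) xor (wBu xor wBw))) ∎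
  expand-zero : Q (zeroΩ d) ≡ c xor (false xor false)
  expand-zero = cong₂ (λ p q → c xor (p xor q)) (dot-zeroʳ a)
                      (trans (cong (λ r → dot r (zeroΩ d)) (vecMat-zero B)) (dot-zeroˡ (zeroΩ d)))
  cancel : ∀ c au aw uBu uBw wBu wBw →
    (c xor ((au xor aw) xor ((uBu xor uBw) xor (wBu xor wBw)))) xor ((c xor (au xor uBu)) xor ((c xor (aw xor wBw)) xor (c xor (false xor false))))
      ≡ uBw xor wBu
  cancel = solve 7 (λ c au aw uBu uBw wBu wBw →
    (c :+ ((au :+ aw) :+ ((uBu :+ uBw) :+ (wBu :+ wBw)))) :+ ((c :+ (au :+ uBu)) :+ ((c :+ (aw :+ wBw)) :+ (c :+ (con false :+ con false))))
      := uBw :+ wBu) refl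

RM2⇒FormLinear : ∀ {d} (A : Subset d) → RM2 A → FormLinear A
RM2⇒FormLinear A (c , a , B , A≐Q) x y v = begin
  formB A (x ⊕ y) v                                    ≡⟨ trans (formB-cong A≐Q (x ⊕ y) v) (quadFun-formB c a B (x ⊕ y) v) ⟩
  dot (vecMat (x ⊕ y) B) v xor dot (vecMat v B) (x ⊕ y)
    ≡⟨ cong₂ _xor_ (trans (cong (λ r → dot r v) (vecMat-distrib x y B)) (dot-distribˡ (vecMat x B) (vecMat y B) v))
                   (dot-distribʳ (vecMat v B) x y) ⟩
  (dot (vecMat x B) v xor dot (vecMat y B) v) xor (dot (vecMat v B) x xor dot (vecMat v B) y)
    ≡⟨ xor-interchange (dot (vecMat x B) v) (dot (vecMat y B) v) (dot (vecMat v B) x) (dot (vecMat v B) y) ⟩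
  (dot (vecMat x B) v xor dot (vecMat v B) x) xor (dot (vecMat y B) v xor dot (vecMat v B) y)
    ≡⟨ sym (cong₂ _xor_ (trans (formB-cong A≐Q x v) (quadFun-formB c a B x v))
                        (trans (formB-cong A≐Q y v) (quadFun-formB c a B y v))) ⟩
  formB A x v xor formB A y v                          ∎

centred : ∀ {d} → Subset d → Subset d
centred {d} A y = A y xor A (zeroΩ d)

bias : ∀ {d} → Subset d → ℤ
bias {d} A = ΣΩ d (λ x → sign (A x))

formSum : ∀ {d} → Subset d → Ω d → ℤ
formSum {d} A y = ΣΩ d (λ x → sign (formB A y x))

radicalSize : ∀ {d} → Subset d → ℕ
radicalSize {d} A = countB (inRadical A) (allΩ d)

radical-orthogonal : ∀ {d} (A : Subset d) {t} → inRadical A t ≡ true → ∀ w → formB A t w ≡ false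
radical-orthogonal A {t} t∈rad w =
  trans (sym (not-involutive (formB A t w))) (cong not (allBΩ-true (λ w → not (formB A t w)) t∈rad w))

nonradical-witness : ∀ {d} (A : Subset d) {t} → inRadical A t ≡ false → ∃ λ w → formB A t w ≡ true
nonradical-witness {d} A {t} t∉rad with Any.satisfied (allB-false (λ w → not (formB A t w)) (allΩ d) t∉rad)
... | w , not-f≡false = w , trans (sym (not-involutive (formB A t w))) (cong not not-f≡false)

bias-square : ∀ {d} (A : Subset d) → bias A *ℤ bias A ≡ ΣΩ d (λ y → sign (centred A y) *ℤ formSum A y)
bias-square {d} A = begin
  bias A *ℤ bias A                                                   ≡⟨ sym (sumℤ-*ʳ (bias A) (λ x → sign (A x)) (allΩ d)) ⟩
  ΣΩ d (λ x → sign (A x) *ℤ bias A)                                  ≡⟨ ΣΩ-cong d (λ x → sym (sumℤ-*ˡ (sign (A x)) (λ y → sign (A y)) (allΩ d))) ⟩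
  ΣΩ d (λ x → ΣΩ d (λ y → sign (A x) *ℤ sign (A y)))                 ≡⟨ ΣΩ-cong d (λ x → ΣΩ-translate d (λ y → sign (A x) *ℤ sign (A y)) x) ⟩
  ΣΩ d (λ x → ΣΩ d (λ y → sign (A x) *ℤ sign (A (y ⊕ x))))             ≡⟨ ΣΩ-cong d (λ x → ΣΩ-cong d (λ y → pair x y)) ⟩
  ΣΩ d (λ x → ΣΩ d (λ y → sign (centred A y) *ℤ sign (formB A y x)))  ≡⟨ sumℤ-swap _ (allΩ d) (allΩ d) ⟩
  ΣΩ d (λ y → ΣΩ d (λ x → sign (centred A y) *ℤ sign (formB A y x)))  ≡⟨ ΣΩ-cong d (λ y → sumℤ-*ˡ (sign (centred A y)) _ (allΩ d)) ⟩
  ΣΩ d (λ y → sign (centred A y) *ℤ formSum A y)                      ∎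
  where
  regroup : ∀ p q z f → p xor (q xor (p xor (z xor f))) ≡ (q xor z) xor f
  regroup = solve 4 (λ p q z f → p :+ (q :+ (p :+ (z :+ f))) := (q :+ z) :+ f) refl
  pair : ∀ x y → sign (A x) *ℤ sign (A (y ⊕ x)) ≡ sign (centred A y) *ℤ sign (formB A y x)
  pair x y = begin
    sign (A x) *ℤ sign (A (y ⊕ x))                                     ≡⟨ sym (sign-xor (A x) (A (y ⊕ x))) ⟩
    sign (A x xor A (y ⊕ x))                                           ≡⟨ cong (λ b → sign (A x xor b)) (⊕-via-formB A y x) ⟩
    sign (A x xor (A y xor (A x xor (A (zeroΩ d) xor formB A y x))))   ≡⟨ cong sign (regroup (A x) (A y) (A (zeroΩ d)) (formB A y x)) ⟩
    sign (centred A y xor formB A y x)                                 ≡⟨ sign-xor (centred A y) (formB A y x) ⟩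
    sign (centred A y) *ℤ sign (formB A y x)                           ∎

formSum-orthogonal : ∀ {d} (A : Subset d) {y} → (∀ x → formB A y x ≡ false) → formSum A y ≡ + (2 ^ d)
formSum-orthogonal {d} A {y} y⊥ = begin
  formSum A y                ≡⟨ ΣΩ-cong d (λ x → cong sign (y⊥ x)) ⟩
  ΣΩ d (λ _ → + 1)           ≡⟨ ΣΩ-one d ⟩
  + (2 ^ d)                  ∎

formSum-nonradical : ∀ {d} (A : Subset d) → FormLinear A → ∀ {y} → inRadical A y ≡ false → formSum A y ≡ + 0
formSum-nonradical {d} A linear {y} y-nonrad with nonradical-witness A y-nonrad
... | w , f-w = ΣΩ-antiperiodic d _ w (λ x → trans
      (cong sign (trans (FormLinear⇒linearʳ A linear y x w) (cong (formB A y x xor_) f-w)))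
      (sign-xor-true (formB A y x)))

formSum-translate-radical : ∀ {d} (A : Subset d) → FormLinear A → ∀ {t} → inRadical A t ≡ true → ∀ y → formSum A (y ⊕ t) ≡ formSum A y
formSum-translate-radical {d} A linear t-rad y = ΣΩ-cong d (λ x → cong sign (trans (linear y _ x)
  (trans (cong (formB A y x xor_) (radical-orthogonal A t-rad x)) (xor-identityʳ (formB A y x)))))

centred-translate : ∀ {d} (A : Subset d) y t → centred A (y ⊕ t) ≡ (centred A y xor centred A t) xor formB A y t
centred-translate {d} A y t = trans (cong (_xor A (zeroΩ d)) (⊕-via-formB A y t)) (regroup (A y) (A t) (A (zeroΩ d)) (formB A y t))
  where
  regroup : ∀ p q z f → (p xor (q xor (z xor f))) xor z ≡ ((p xor z) xor (q xor z)) xor f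
  regroup = solve 4 (λ p q z f → (p :+ (q :+ (z :+ f))) :+ z := ((p :+ z) :+ (q :+ z)) :+ f) refl

bias-square-term-antiperiodic : ∀ {d} (A : Subset d) → FormLinear A → ∀ {t} → inRadical A t ≡ true → centred A t ≡ true →
  ∀ y → sign (centred A (y ⊕ t)) *ℤ formSum A (y ⊕ t) ≡ - (sign (centred A y) *ℤ formSum A y)
bias-square-term-antiperiodic {d} A linear {t} t-rad t-odd y with inRadical A y in y-rad
... | true = begin
  sign (centred A (y ⊕ t)) *ℤ formSum A (y ⊕ t)
    ≡⟨ cong₂ _*ℤ_ (cong sign flipped) (formSum-translate-radical A linear t-rad y) ⟩
  sign (centred A y xor true) *ℤ formSum A y       ≡⟨ cong (_*ℤ formSum A y) (sign-xor-true (centred A y)) ⟩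
  - sign (centred A y) *ℤ formSum A y              ≡⟨ sym (ℤ.neg-distribˡ-* (sign (centred A y)) (formSum A y)) ⟩
  - (sign (centred A y) *ℤ formSum A y)            ∎
  where
  flipped : centred A (y ⊕ t) ≡ centred A y xor true
  flipped = begin
    centred A (y ⊕ t)                                ≡⟨ centred-translate A y t ⟩
    (centred A y xor centred A t) xor formB A y t    ≡⟨ cong₂ (λ b f → (centred A y xor b) xor f) t-odd (radical-orthogonal A y-rad t) ⟩
    (centred A y xor true) xor false                 ≡⟨ xor-identityʳ (centred A y xor true) ⟩
    centred A y xor true                             ∎
... | false = begin
  sign (centred A (y ⊕ t)) *ℤ formSum A (y ⊕ t)    ≡⟨ cong (sign (centred A (y ⊕ t)) *ℤ_) (trans (formSum-translate-radical A linear t-rad y) zero-y) ⟩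
  sign (centred A (y ⊕ t)) *ℤ + 0                  ≡⟨ ℤ.*-zeroʳ (sign (centred A (y ⊕ t))) ⟩
  + 0                                              ≡⟨ cong -_ (sym (trans (cong (sign (centred A y) *ℤ_) zero-y) (ℤ.*-zeroʳ (sign (centred A y))))) ⟩
  - (sign (centred A y) *ℤ formSum A y)            ∎
  where
  zero-y : formSum A y ≡ + 0
  zero-y = formSum-nonradical A linear y-rad

bias-square-term-even : ∀ {d} (A : Subset d) → FormLinear A → (∀ t → inRadical A t ≡ true → centred A t ≡ false) →
  ∀ y → sign (centred A y) *ℤ formSum A y ≡ + (2 ^ d) *ℤ (if inRadical A y then + 1 else + 0)
bias-square-term-even {d} A linear even y with inRadical A y in y-rad
... | true = begin
  sign (centred A y) *ℤ formSum A y   ≡⟨ cong₂ _*ℤ_ (cong sign (even y y-rad)) (formSum-orthogonal A (radical-orthogonal A y-rad)) ⟩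
  + 1 *ℤ + (2 ^ d)                    ≡⟨ ℤ.*-comm (+ 1) (+ (2 ^ d)) ⟩
  + (2 ^ d) *ℤ + 1                    ∎
... | false = trans (cong (sign (centred A y) *ℤ_) (formSum-nonradical A linear y-rad))
                    (trans (ℤ.*-zeroʳ (sign (centred A y))) (sym (ℤ.*-zeroʳ (+ (2 ^ d)))))

bias-square-cases : ∀ {d} (A : Subset d) → FormLinear A →
  bias A *ℤ bias A ≡ + 0 ⊎ bias A *ℤ bias A ≡ + (2 ^ d) *ℤ + radicalSize A
bias-square-cases {d} A linear with ∃Ω? (λ t → (inRadical A t ≟ᵇ true) ×-dec (centred A t ≟ᵇ true))
... | yes (t , t-rad , t-odd) =
  inj₁ (trans (bias-square A) (ΣΩ-antiperiodic d _ t (bias-square-term-antiperiodic A linear t-rad t-odd)))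
... | no none = inj₂ (begin
  bias A *ℤ bias A                                                    ≡⟨ bias-square A ⟩
  ΣΩ d (λ y → sign (centred A y) *ℤ formSum A y)                      ≡⟨ ΣΩ-cong d (bias-square-term-even A linear even) ⟩
  ΣΩ d (λ y → + (2 ^ d) *ℤ (if inRadical A y then + 1 else + 0))      ≡⟨ sumℤ-*ˡ (+ (2 ^ d)) _ (allΩ d) ⟩
  + (2 ^ d) *ℤ ΣΩ d (λ y → if inRadical A y then + 1 else + 0)        ≡⟨ cong (+ (2 ^ d) *ℤ_) (sumℤ-countB (inRadical A) (allΩ d)) ⟩
  + (2 ^ d) *ℤ + radicalSize A                                        ∎)
  where
  even : ∀ t → inRadical A t ≡ true → centred A t ≡ false
  even t t-rad = ¬-not (λ t-odd → none (t , t-rad , t-odd))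

affineVanishingAt : ∀ {d} → Ω d → Ω d → Subset d
affineVanishingAt ω₀ u = affineFun (dot u ω₀) u

ΣΩ-bias-twists : ∀ {d} (A : Subset d) (ω₀ : Ω d) →
  ΣΩ d (λ u → bias (A △ affineVanishingAt ω₀ u)) ≡ + (2 ^ d) *ℤ sign (A ω₀)
ΣΩ-bias-twists {d} A ω₀ = begin
  ΣΩ d (λ u → ΣΩ d (λ x → sign (A x xor (dot u ω₀ xor dot u x))))
    ≡⟨ ΣΩ-cong d (λ u → ΣΩ-cong d (λ x → term u x)) ⟩
  ΣΩ d (λ u → ΣΩ d (λ x → sign (A x) *ℤ sign (dot u (ω₀ ⊕ x))))   ≡⟨ sumℤ-swap _ (allΩ d) (allΩ d) ⟩
  ΣΩ d (λ x → ΣΩ d (λ u → sign (A x) *ℤ sign (dot u (ω₀ ⊕ x))))   ≡⟨ ΣΩ-cong d (λ x → sumℤ-*ˡ (sign (A x)) _ (allΩ d)) ⟩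
  ΣΩ d (λ x → sign (A x) *ℤ characterSum d (ω₀ ⊕ x))              ≡⟨ ΣΩ-translate d _ ω₀ ⟩
  ΣΩ d (λ x → sign (A (x ⊕ ω₀)) *ℤ characterSum d (ω₀ ⊕ (x ⊕ ω₀)))
    ≡⟨ ΣΩ-cong d (λ x → cong (λ y → sign (A (x ⊕ ω₀)) *ℤ characterSum d y) (trans (⊕-comm ω₀ (x ⊕ ω₀)) (⊕-cancelʳ x ω₀))) ⟩
  ΣΩ d (λ x → sign (A (x ⊕ ω₀)) *ℤ characterSum d x)              ≡⟨ ΣΩ-sift d (λ x → sign (A (x ⊕ ω₀))) ⟩
  + (2 ^ d) *ℤ sign (A (zeroΩ d ⊕ ω₀))                            ≡⟨ cong (λ y → + (2 ^ d) *ℤ sign (A y)) (⊕-identityˡ ω₀) ⟩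
  + (2 ^ d) *ℤ sign (A ω₀)                                        ∎
  where
  term : ∀ u x → sign (A x xor (dot u ω₀ xor dot u x)) ≡ sign (A x) *ℤ sign (dot u (ω₀ ⊕ x))
  term u x = trans (cong (λ b → sign (A x xor b)) (sym (dot-distribʳ u ω₀ x))) (sign-xor (A x) (dot u (ω₀ ⊕ x)))

centred-△-affine : ∀ {d} (A : Subset d) c a y → centred (A △ affineFun c a) y ≡ centred A y xor dot a y
centred-△-affine {d} A c a y = begin
  (A y xor (c xor dot a y)) xor (A (zeroΩ d) xor (c xor dot a (zeroΩ d)))
    ≡⟨ cong (λ b → (A y xor (c xor dot a y)) xor (A (zeroΩ d) xor (c xor b))) (dot-zeroʳ a) ⟩
  (A y xor (c xor dot a y)) xor (A (zeroΩ d) xor (c xor false))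
    ≡⟨ regroup (A y) (A (zeroΩ d)) c (dot a y) ⟩
  centred A y xor dot a y ∎
  where
  regroup : ∀ p z c q → (p xor (c xor q)) xor (z xor (c xor false)) ≡ (p xor z) xor q
  regroup = solve 4 (λ p z c q → (p :+ (c :+ q)) :+ (z :+ (c :+ con false)) := (p :+ z) :+ q) refl

ΣΩ-bias-twists-square : ∀ {d} (A : Subset d) (ω₀ : Ω d) →
  ΣΩ d (λ u → bias (A △ affineVanishingAt ω₀ u) *ℤ bias (A △ affineVanishingAt ω₀ u)) ≡ + (2 ^ d) *ℤ + (2 ^ d)
ΣΩ-bias-twists-square {d} A ω₀ = begin
  ΣΩ d (λ u → bias (A △ L u) *ℤ bias (A △ L u))                  ≡⟨ ΣΩ-cong d (λ u → trans (bias-square (A △ L u)) (ΣΩ-cong d (term u))) ⟩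
  ΣΩ d (λ u → ΣΩ d (λ y → g y *ℤ sign (dot u y)))                ≡⟨ sumℤ-swap _ (allΩ d) (allΩ d) ⟩
  ΣΩ d (λ y → ΣΩ d (λ u → g y *ℤ sign (dot u y)))                ≡⟨ ΣΩ-cong d (λ y → sumℤ-*ˡ (g y) _ (allΩ d)) ⟩
  ΣΩ d (λ y → g y *ℤ characterSum d y)                           ≡⟨ ΣΩ-sift d g ⟩
  + (2 ^ d) *ℤ (sign (centred A (zeroΩ d)) *ℤ formSum A (zeroΩ d))
    ≡⟨ cong₂ (λ b s → + (2 ^ d) *ℤ (sign b *ℤ s)) (xor-same (A (zeroΩ d))) (formSum-orthogonal A (formB-zeroˡ A)) ⟩
  + (2 ^ d) *ℤ (+ 1 *ℤ + (2 ^ d))                                ≡⟨ cong (+ (2 ^ d) *ℤ_) (ℤ.*-identityˡ (+ (2 ^ d))) ⟩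
  + (2 ^ d) *ℤ + (2 ^ d)                                         ∎
  where
  L : Ω d → Subset d
  L = affineVanishingAt ω₀
  g : Ω d → ℤ
  g y = sign (centred A y) *ℤ formSum A y
  term : ∀ u y → sign (centred (A △ L u) y) *ℤ formSum (A △ L u) y ≡ g y *ℤ sign (dot u y)
  term u y = begin
    sign (centred (A △ L u) y) *ℤ formSum (A △ L u) y
      ≡⟨ cong₂ _*ℤ_ (trans (cong sign (centred-△-affine A (dot u ω₀) u y)) (sign-xor (centred A y) (dot u y)))
                    (ΣΩ-cong d (λ x → cong sign (formB-△-affine A (dot u ω₀) u y x))) ⟩
    (sign (centred A y) *ℤ sign (dot u y)) *ℤ formSum A y        ≡⟨ ℤ.*-assoc (sign (centred A y)) _ _ ⟩
    sign (centred A y) *ℤ (sign (dot u y) *ℤ formSum A y)        ≡⟨ cong (sign (centred A y) *ℤ_) (ℤ.*-comm (sign (dot u y)) _) ⟩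
    sign (centred A y) *ℤ (formSum A y *ℤ sign (dot u y))        ≡⟨ sym (ℤ.*-assoc (sign (centred A y)) _ _) ⟩
    g y *ℤ sign (dot u y)                                        ∎

FormLinear-△-affine : ∀ {d} (A : Subset d) c a → FormLinear A → FormLinear (A △ affineFun c a)
FormLinear-△-affine A c a linear x y v = begin
  formB (A △ affineFun c a) (x ⊕ y) v                          ≡⟨ formB-△-affine A c a (x ⊕ y) v ⟩
  formB A (x ⊕ y) v                                            ≡⟨ linear x y v ⟩
  formB A x v xor formB A y v                                  ≡⟨ sym (cong₂ _xor_ (formB-△-affine A c a x v) (formB-△-affine A c a y v)) ⟩
  formB (A △ affineFun c a) x v xor formB (A △ affineFun c a) y v ∎

radicalSize-△-affine : ∀ {d} (A : Subset d) c a → radicalSize (A △ affineFun c a) ≡ radicalSize A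
radicalSize-△-affine {d} A c a = countB-cong (allΩ d) (λ t → allB-cong (allΩ d) (λ w → cong not (formB-△-affine A c a t w)))

m*m≡n*n⇒m≡n : ∀ m n → m * m ≡ n * n → m ≡ n
m*m≡n*n⇒m≡n m n m²≡n² with ℕ.<-cmp m n
... | tri≈ _ m≡n _ = m≡n
... | tri< m<n _ _ = ⊥-elim (ℕ.<-irrefl m²≡n² (ℕ.*-mono-< m<n m<n))
... | tri> _ _ n<m = ⊥-elim (ℕ.<-irrefl (sym m²≡n²) (ℕ.*-mono-< n<m n<m))

ZeroOrPlusMinus : ℕ → ℤ → Set
ZeroOrPlusMinus n z = z ≡ + 0 ⊎ z ≡ + n ⊎ z ≡ - + n

i*i≡n*n⇒i≡±n : ∀ z n → z *ℤ z ≡ + (n * n) → z ≡ + n ⊎ z ≡ - + n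
i*i≡n*n⇒i≡±n z n z²≡n² with m*m≡n*n⇒m≡n ∣ z ∣ n (trans (sym (ℤ.abs-* z z)) (cong ∣_∣ z²≡n²)) | ℤ.+∣i∣≡i⊎+∣i∣≡-i z
... | refl | inj₁ +∣z∣≡z = inj₁ (sym +∣z∣≡z)
... | refl | inj₂ +∣z∣≡-z = inj₂ (trans (sym (ℤ.neg-involutive z)) (cong -_ (sym +∣z∣≡-z)))

defect-square : ∀ d k R → R * 2 ^ (2 * k) ≡ 2 ^ d → 2 ^ d * R ≡ 2 ^ (d ∸ k) * 2 ^ (d ∸ k)
defect-square d k R defect with 2 * k ℕ.≤? d
... | no d<2k = ⊥-elim (ℕ.<-irrefl (sym defect) (ℕ.<-≤-trans (ℕ.^-monoʳ-< 2 (s≤s (s≤s z≤n)) (ℕ.≰⇒> d<2k)) 2^2k≤))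
  where
  R≢0 : R ≢ 0
  R≢0 R≡0 = ℕ.<-irrefl (trans (sym (cong (_* 2 ^ (2 * k)) R≡0)) defect) (ℕ.m^n>0 2 d)
  2^2k≤ : 2 ^ (2 * k) ≤ R * 2 ^ (2 * k)
  2^2k≤ = ℕ.m≤n*m (2 ^ (2 * k)) R {{≢-nonZero R≢0}}
... | yes 2k≤d rewrite sym (ℕ.m+[n∸m]≡n 2k≤d) = exact (d ∸ 2 * k) defect
  where
  exact : ∀ e → R * 2 ^ (2 * k) ≡ 2 ^ (2 * k ℕ+ e) → 2 ^ (2 * k ℕ+ e) * R ≡ 2 ^ (2 * k ℕ+ e ∸ k) * 2 ^ (2 * k ℕ+ e ∸ k)
  exact e defect′ = begin
    2 ^ (2 * k ℕ+ e) * R              ≡⟨ cong (2 ^ (2 * k ℕ+ e) *_) R≡2^e ⟩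
    2 ^ (2 * k ℕ+ e) * 2 ^ e          ≡⟨ sym (ℕ.^-distribˡ-+-* 2 (2 * k ℕ+ e) e) ⟩
    2 ^ (2 * k ℕ+ e ℕ+ e)             ≡⟨ cong (2 ^_) (exponents k e) ⟩
    2 ^ ((k ℕ+ e) ℕ+ (k ℕ+ e))        ≡⟨ ℕ.^-distribˡ-+-* 2 (k ℕ+ e) (k ℕ+ e) ⟩
    2 ^ (k ℕ+ e) * 2 ^ (k ℕ+ e)       ≡⟨ cong (λ i → 2 ^ i * 2 ^ i) (sym halve) ⟩
    2 ^ (2 * k ℕ+ e ∸ k) * 2 ^ (2 * k ℕ+ e ∸ k) ∎
    where
    exponents : ∀ k e → 2 * k ℕ+ e ℕ+ e ≡ (k ℕ+ e) ℕ+ (k ℕ+ e)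
    exponents = ℕ-solve-∀
    halve : 2 * k ℕ+ e ∸ k ≡ k ℕ+ e
    halve = trans (cong (_∸ k) (regroup k e)) (ℕ.m+n∸m≡n k (k ℕ+ e))
      where
      regroup : ∀ k e → 2 * k ℕ+ e ≡ k ℕ+ (k ℕ+ e)
      regroup = ℕ-solve-∀
    R≡2^e : R ≡ 2 ^ e
    R≡2^e = ℕ.*-cancelʳ-≡ R (2 ^ e) (2 ^ (2 * k)) {{ℕ.m^n≢0 2 (2 * k)}}
      (trans defect′ (trans (ℕ.^-distribˡ-+-* 2 (2 * k) e) (ℕ.*-comm (2 ^ (2 * k)) (2 ^ e))))

bias-values : ∀ {d} (A : Subset d) k → FormLinear A → HasDefect A k → ZeroOrPlusMinus (2 ^ (d ∸ k)) (bias A)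
bias-values {d} A k linear defect with bias-square-cases A linear
... | inj₁ b²≡0 = inj₁ ([ id , id ]′ (i*i≡n*n⇒i≡±n (bias A) 0 b²≡0))
... | inj₂ b²≡2^dR = inj₂ (i*i≡n*n⇒i≡±n (bias A) (2 ^ (d ∸ k))
        (trans b²≡2^dR (trans (sym (ℤ.pos-* (2 ^ d) (radicalSize A))) (cong +_ (defect-square d k (radicalSize A) defect)))))

twisted-bias-values : ∀ {d} (A : Subset d) k → FormLinear A → HasDefect A k →
  ∀ ω₀ u → ZeroOrPlusMinus (2 ^ (d ∸ k)) (bias (A △ affineVanishingAt ω₀ u))
twisted-bias-values {d} A k linear defect ω₀ u =
  bias-values (A △ affineVanishingAt ω₀ u) k (FormLinear-△-affine A (dot u ω₀) u linear)
    (trans (cong (λ r → r * 2 ^ (2 * k)) (radicalSize-△-affine A (dot u ω₀) u)) defect)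

+≢-+ : ∀ a {b} → 0 < b → + a ≢ - + b
+≢-+ a {suc b} _ ()

both-signs-occur : ∀ {d n} (W : Ω d → ℤ) → 0 < n → n < 2 ^ d → (∀ u → ZeroOrPlusMinus n (W u)) →
  ΣΩ d W ≡ + (2 ^ d) → ΣΩ d (λ u → W u *ℤ W u) ≡ + (2 ^ d) *ℤ + (2 ^ d) →
  (∃ λ u → W u ≡ + n) × (∃ λ u → W u ≡ - + n)
both-signs-occur {d} {n} W 0<n n<2^d values ΣW ΣW² = positive , negative
  where
  ΣW²-scaled : ∀ c → (∀ u → W u *ℤ W u ≡ c *ℤ W u) → + (2 ^ d * 2 ^ d) ≡ c *ℤ + (2 ^ d)
  ΣW²-scaled c W²≡cW = begin
    + (2 ^ d * 2 ^ d)              ≡⟨ ℤ.pos-* (2 ^ d) (2 ^ d) ⟩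
    + (2 ^ d) *ℤ + (2 ^ d)         ≡⟨ sym ΣW² ⟩
    ΣΩ d (λ u → W u *ℤ W u)        ≡⟨ ΣΩ-cong d W²≡cW ⟩
    ΣΩ d (λ u → c *ℤ W u)          ≡⟨ sumℤ-*ˡ c W (allΩ d) ⟩
    c *ℤ ΣΩ d W                    ≡⟨ cong (c *ℤ_) ΣW ⟩
    c *ℤ + (2 ^ d)                 ∎
  positive : ∃ λ u → W u ≡ + n
  positive with ∃Ω? (λ u → W u ℤ.≟ + n)
  ... | yes found = found
  ... | no none = ⊥-elim (+≢-+ (2 ^ d * 2 ^ d) (ℕ.*-mono-< 0<n (ℕ.m^n>0 2 d))
          (trans (ΣW²-scaled (- + n) W²≡-nW) (trans (sym (ℤ.neg-distribˡ-* (+ n) (+ (2 ^ d)))) (cong -_ (sym (ℤ.pos-* n (2 ^ d)))))))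
    where
    W²≡-nW : ∀ u → W u *ℤ W u ≡ - + n *ℤ W u
    W²≡-nW u with values u
    ... | inj₁ Wu≡0 rewrite Wu≡0 = sym (ℤ.*-zeroʳ (- + n))
    ... | inj₂ (inj₁ Wu≡n) = ⊥-elim (none (u , Wu≡n))
    ... | inj₂ (inj₂ Wu≡-n) rewrite Wu≡-n = refl
  negative : ∃ λ u → W u ≡ - + n
  negative with ∃Ω? (λ u → W u ℤ.≟ - + n)
  ... | yes found = found
  ... | no none = ⊥-elim (ℕ.<-irrefl n≡2^d n<2^d)
    where
    W²≡nW : ∀ u → W u *ℤ W u ≡ + n *ℤ W u
    W²≡nW u with values u
    ... | inj₁ Wu≡0 rewrite Wu≡0 = sym (ℤ.*-zeroʳ (+ n))
    ... | inj₂ (inj₁ Wu≡n) rewrite Wu≡n = refl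
    ... | inj₂ (inj₂ Wu≡-n) = ⊥-elim (none (u , Wu≡-n))
    n≡2^d : n ≡ 2 ^ d
    n≡2^d = sym (ℕ.*-cancelʳ-≡ (2 ^ d) n (2 ^ d) {{ℕ.m^n≢0 2 d}}
      (ℤ.+-injective (trans (ΣW²-scaled (+ n) W²≡nW) (sym (ℤ.pos-* n (2 ^ d))))))

inner-x0ε-∅ : ∀ {d} (X : Subset d) → inner (x0ε ∅) (x0ε X) ≡ bias X
inner-x0ε-∅ {d} X = ΣΩ-cong d (λ ω → ℤ.*-identityˡ (sign (X ω)))

x0ε-∅≐⇒bias : ∀ {d} (X : Subset d) → x0ε ∅ ≐' x0ε X → bias X ≡ + (2 ^ d)
x0ε-∅≐⇒bias {d} X ∅≐X = begin
  bias X                     ≡⟨ ΣΩ-cong d (λ ω → sym (∅≐X ω)) ⟩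
  ΣΩ d (λ _ → + 1)           ≡⟨ ΣΩ-one d ⟩
  + (2 ^ d)                  ∎

module _ {a ℓ} (S : Setoid a ℓ) where
  open Setoid S using (Carrier; _≈_) renaming (sym to ≈-sym)
  open SetoidMembership S using () renaming (_∈_ to _∈ₛ_)

  unique-lookup-injective : ∀ {xs} → Unique S xs → ∀ i j → lookup xs i ≈ lookup xs j → i ≡ j
  unique-lookup-injective (_ ∷ _) zero zero _ = refl
  unique-lookup-injective (x≉xs ∷ _) zero (suc j) x≈ = ⊥-elim (All.lookup x≉xs (∈-lookup j) x≈)
  unique-lookup-injective (x≉xs ∷ _) (suc i) zero ≈x = ⊥-elim (All.lookup x≉xs (∈-lookup i) (≈-sym ≈x))
  unique-lookup-injective (_ ∷ xs!) (suc i) (suc j) eq = cong suc (unique-lookup-injective xs! i j eq)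

  unique⇒length≤ : ∀ {xs ys} → Unique S xs → All (_∈ₛ ys) xs → length xs ≤ length ys
  unique⇒length≤ {xs} xs! xs⊆ys = injective⇒≤ {f = position} position-injective
    where
    position : Fin (length xs) → Fin _
    position i = Any.index (All.lookup xs⊆ys (∈-lookup i))
    position-injective : ∀ {i j} → position i ≡ position j → i ≡ j
    position-injective {i} {j} eq = unique-lookup-injective xs! i j
      (index-injective S (All.lookup xs⊆ys (∈-lookup i)) (All.lookup xs⊆ys (∈-lookup j)) eq)

  countB≤length : ∀ {P : Carrier → Bool} {xs ys} → Unique S xs → All (λ x → P x ≡ true → x ∈ₛ ys) xs → countB P xs ≤ length ys
  countB≤length {P} {xs} xs! P⊆ys = ℕ.≤-trans (ℕ.≤-reflexive (countB≡length-filter xs))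
    (unique⇒length≤ (Unique.filter⁺ S P? xs!)
      (All.zipWith (λ (Px , Px⇒∈) → Px⇒∈ Px) (All.all-filter P? xs , All.filter⁺ P? P⊆ys)))
    where
    P? : Decidable (λ x → P x ≡ true)
    P? x = P x ≟ᵇ true
    countB≡length-filter : ∀ xs → countB P xs ≡ length (filter P? xs)
    countB≡length-filter [] = refl
    countB≡length-filter (x ∷ xs) with P x
    ... | true = cong suc (countB≡length-filter xs)
    ... | false = countB≡length-filter xs

≐-setoid : ℕ → Setoid 0ℓ 0ℓ
≐-setoid d = Ω d →-setoid Bool

concatMap-map≡cartesianProductWith : ∀ {A B C : Set} (f : A → B → C) xs ys →
  concatMap (λ x → map (f x) ys) xs ≡ cartesianProductWith f xs ys
concatMap-map≡cartesianProductWith f [] ys = refl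
concatMap-map≡cartesianProductWith f (x ∷ xs) ys = cong (map (f x) ys ++_) (concatMap-map≡cartesianProductWith f xs ys)

allSubsets-unique : ∀ d → Unique (≐-setoid d) (allSubsets d)
allSubsets-unique zero = ((λ same → case same [] of λ ()) ∷ []) ∷ [] ∷ []
allSubsets-unique (suc d) = unique-grid _ (λ _ _ _ → refl) (λ _ _ _ → refl)
  where
  unique-grid : (glue : Subset d → Subset d → Subset (suc d)) →
    (∀ f h v → glue f h (true ∷ v) ≡ f v) → (∀ f h v → glue f h (false ∷ v) ≡ h v) →
    Unique (≐-setoid (suc d)) (concatMap (λ f → map (glue f) (allSubsets d)) (allSubsets d))
  unique-grid glue glue-true glue-false =
    subst (Unique (≐-setoid (suc d))) (sym (concatMap-map≡cartesianProductWith glue (allSubsets d) (allSubsets d)))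
      (Unique.cartesianProductWith⁺ (≐-setoid d) (≐-setoid d) (≐-setoid (suc d)) glue glue-injective
        (allSubsets-unique d) (allSubsets-unique d))
    where
    glue-injective : ∀ {f f′ h h′} → glue f h ≐ glue f′ h′ → f ≐ f′ × h ≐ h′
    glue-injective {f} {f′} {h} {h′} same =
      (λ v → trans (sym (glue-true f h v)) (trans (same (true ∷ v)) (glue-true f′ h′ v))) ,
      (λ v → trans (sym (glue-false f h v)) (trans (same (false ∷ v)) (glue-false f′ h′ v)))

_≐?_ : ∀ {d} (X Y : Subset d) → Dec (X ≐ Y)
_≐?_ {d} X Y = Dec.map′ (λ all ω → All.lookup all (allΩ-complete d ω)) (λ X≐Y → All.tabulate (λ {ω} _ → X≐Y ω))
  (All.all? (λ ω → X ω ≟ᵇ Y ω) (allΩ d))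

_∈≐?_ : ∀ {d} (A : Subset d) (As : List (Subset d)) → Dec (Any (A ≐_) As)
A ∈≐? As = any? (A ≐?_) As

affinesVanishingAt : ∀ {d} → Ω d → List (Subset d)
affinesVanishingAt {d} ω₀ = map (affineVanishingAt ω₀) (allΩ d)

RM1⇒∈affinesVanishingAt : ∀ {d} {A : Subset d} (ω₀ : Ω d) → RM1 A → A ω₀ ≡ false → Any (A ≐_) (affinesVanishingAt ω₀)
RM1⇒∈affinesVanishingAt {d} {A} ω₀ (c , a , A≐) Aω₀≡false = Any.map⁺ (Any.map (λ { refl → A≐L }) (allΩ-complete d a))
  where
  A≐L : A ≐ affineVanishingAt ω₀ a
  A≐L ω = trans (A≐ ω) (cong (_xor dot a ω) (xor≡false⇒≡ c (dot a ω₀) (trans (sym (A≐ ω₀)) Aω₀≡false)))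

countB-affine-bound : ∀ {d} (ω₀ : Ω d) (J : Subset d → Bool) →
  All (λ A → J A ≡ true → Any (A ≐_) (affinesVanishingAt ω₀)) (allSubsets d) → countB J (allSubsets d) ≤ 2 ^ d
countB-affine-bound {d} ω₀ J J⊆affines = ℕ.≤-trans (countB≤length (≐-setoid d) (allSubsets-unique d) J⊆affines)
  (ℕ.≤-reflexive (trans (length-map _ (allΩ d)) (length-allΩ d)))

nonaffine-member : ∀ {d} (ω₀ : Ω d) (J : Subset d → Bool) → (∀ A → J A ≡ true → A ω₀ ≡ false) →
  2 ^ d < countB J (allSubsets d) → ∃ λ A → J A ≡ true × ¬ RM1 A
nonaffine-member {d} ω₀ J J∌ω₀ many with any? (λ A → (J A ≟ᵇ true) ×-dec ¬? (A ∈≐? affinesVanishingAt ω₀)) (allSubsets d)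
... | yes found = nonaffine (Any.satisfied found)
  where
  nonaffine : (∃ λ A → J A ≡ true × ¬ Any (A ≐_) (affinesVanishingAt ω₀)) → ∃ λ A → J A ≡ true × ¬ RM1 A
  nonaffine (A , A∈J , A∉affines) = A , A∈J , λ A-affine → A∉affines (RM1⇒∈affinesVanishingAt ω₀ A-affine (J∌ω₀ A A∈J))
... | no none = ⊥-elim (ℕ.<⇒≱ many (countB-affine-bound ω₀ J (All.map J⇒affine (¬Any⇒All¬ _ none))))
  where
  J⇒affine : ∀ {A} → ¬ (J A ≡ true × ¬ Any (A ≐_) (affinesVanishingAt ω₀)) → J A ≡ true → Any (A ≐_) (affinesVanishingAt ω₀)
  J⇒affine {A} ¬found A∈J = decidable-stable (A ∈≐? affinesVanishingAt ω₀) (λ A∉ → ¬found (A∈J , A∉))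

m∸n<m : ∀ m n → 0 < m → 0 < n → m ∸ n < m
m∸n<m (suc m) (suc n) _ _ = s≤s (ℕ.m∸n≤m m n)

pair-with-∅ : ∀ {d} (J : Subset d → Bool) → J ∅ ≡ true → ∀ X {z} → J X ≡ true → bias X ≡ z → z ≢ + (2 ^ d) →
  Σ (Subset d) λ A → Σ (Subset d) λ A′ → J A ≡ true × J A′ ≡ true × ¬ (x0ε A ≐' x0ε A′) × inner (x0ε A) (x0ε A′) ≡ z
pair-with-∅ J J∅ X X∈J biasX≡z z≢2^d =
  ∅ , X , J∅ , X∈J , (λ same → z≢2^d (trans (sym biasX≡z) (x0ε-∅≐⇒bias X same))) , trans (inner-x0ε-∅ X) biasX≡z

lemma3p3 :
    (d : ℕ) → 3 ≤ d →
    (m : ℕ) → 3 ≤ m → m ≤ d → Prime (2 ^ m ∸ 1) →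
    -- g ∈ P ≅ AGL(d,2): ω ↦ ωM + b, of order p = 2^m − 1, fixing ω₀
    (M : Matrix d) → Invertible M → (b : Ω d) →
    iter (2 ^ m ∸ 1) (affApply M b) ≐' (λ ω → ω) →
    (∀ n → 0 < n → n < 2 ^ m ∸ 1 → ¬ (iter n (affApply M b) ≐' (λ ω → ω))) →
    (ω₀ : Ω d) → affApply M b ω₀ ≡ ω₀ →
    -- J ≤ D, given by its (Boolean) membership predicate on subsets A ⊆ Ω
    (J : Subset d → Bool) →
    (∀ A B → A ≐ B → J A ≡ true → J B ≡ true) →
    J ∅ ≡ true →
    (∀ A B → J A ≡ true → J B ≡ true → J (A △ B) ≡ true) →
    (∀ A → J A ≡ true → RM2 A) →
    -- J is ⟨g⟩-invariant
    (∀ A → J A ≡ true → J (λ ω → A (affApply M b ω)) ≡ true) →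
    -- ω₀ ∉ A for all ε_A ∈ J
    (∀ A → J A ≡ true → A ω₀ ≡ false) →
    -- J ∩ D₁ = {ε_A : A ∈ RM(1,d), ω₀ ∉ A}
    (∀ A → J A ≡ true → RM1 A → A ω₀ ≡ false) →
    (∀ A → RM1 A → A ω₀ ≡ false → J A ≡ true) →
    -- |J / (J ∩ D₁)| = 2^m, where |J ∩ D₁| = 2^d
    countB J (allSubsets d) ≡ 2 ^ m * 2 ^ d →
    -- J/(J ∩ D₁) is an irreducible F₂⟨g⟩-module: every ⟨g⟩-invariant subgroup K
    -- with J ∩ D₁ ≤ K ≤ J equals J ∩ D₁ or J
    ((K : Subset d → Bool) →
      (∀ A B → A ≐ B → K A ≡ true → K B ≡ true) →
      K ∅ ≡ true →
      (∀ A B → K A ≡ true → K B ≡ true → K (A △ B) ≡ true) →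
      (∀ A → K A ≡ true → K (λ ω → A (affApply M b ω)) ≡ true) →
      (∀ A → J A ≡ true → RM1 A → K A ≡ true) →
      (∀ A → K A ≡ true → J A ≡ true) →
      (∀ A → K A ≡ true → RM1 A) ⊎ (∀ A → J A ≡ true → K A ≡ true)) →
    -- all elements of J ∖ (J ∩ D₁) have the same defect k ≥ 1
    (k : ℕ) → 1 ≤ k →
    (∀ A → J A ≡ true → ¬ RM1 A → HasDefect A k) →
    -- conclusion
    (Σ (Subset d) λ A → Σ (Subset d) λ A' →
       J A ≡ true × J A' ≡ true × ¬ (x0ε A ≐' x0ε A') ×
       inner (x0ε A) (x0ε A') ≡ + (2 ^ (d ∸ k)))
    ×
    (Σ (Subset d) λ A → Σ (Subset d) λ A' →
       J A ≡ true × J A' ≡ true × ¬ (x0ε A ≐' x0ε A') ×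
       inner (x0ε A) (x0ε A') ≡ - (+ (2 ^ (d ∸ k))))
lemma3p3 d 3≤d m 3≤m _ _ _ _ _ _ _ ω₀ _ J _ J∅ J△ J⊆RM2 _ J∌ω₀ _ RM1⊆J |J| _ k 1≤k defect =
  let (A , A∈J , A∉RM1) = nonaffine-member ω₀ J J∌ω₀ many
      twist : Ω d → Subset d
      twist u = A △ affineVanishingAt ω₀ u
      twist∈J : ∀ u → J (twist u) ≡ true
      twist∈J u = J△ A _ A∈J (RM1⊆J _ (dot u ω₀ , u , λ _ → refl) (xor-same (dot u ω₀)))
      Σbias : ΣΩ d (λ u → bias (twist u)) ≡ + (2 ^ d)
      Σbias = trans (ΣΩ-bias-twists A ω₀) (trans (cong (λ b → + (2 ^ d) *ℤ sign b) (J∌ω₀ A A∈J)) (ℤ.*-identityʳ (+ (2 ^ d))))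
      ((u⁺ , bias⁺) , (u⁻ , bias⁻)) = both-signs-occur (λ u → bias (twist u)) 0<n n<2^d
        (twisted-bias-values A k (RM2⇒FormLinear A (J⊆RM2 A A∈J)) (defect A A∈J A∉RM1) ω₀) Σbias (ΣΩ-bias-twists-square A ω₀)
  in pair-with-∅ J J∅ (twist u⁺) (twist∈J u⁺) bias⁺ (λ n≡2^d → ℕ.<-irrefl (ℤ.+-injective n≡2^d) n<2^d) ,
     pair-with-∅ J J∅ (twist u⁻) (twist∈J u⁻) bias⁻ (λ -n≡2^d → +≢-+ (2 ^ d) 0<n (sym -n≡2^d))
  where
  0<n : 0 < 2 ^ (d ∸ k)
  0<n = ℕ.m^n>0 2 (d ∸ k)
  n<2^d : 2 ^ (d ∸ k) < 2 ^ d
  n<2^d = ℕ.^-monoʳ-< 2 (s≤s (s≤s z≤n)) (m∸n<m d k (ℕ.<-≤-trans (s≤s z≤n) 3≤d) 1≤k)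
  many : 2 ^ d < countB J (allSubsets d)
  many = ℕ.<-≤-trans (ℕ.m<m*n (2 ^ d) (2 ^ m) {{ℕ.m^n≢0 2 d}} (ℕ.^-monoʳ-< 2 (s≤s (s≤s z≤n)) (ℕ.<-≤-trans (s≤s z≤n) 3≤m)))
                     (ℕ.≤-reflexive (trans (ℕ.*-comm (2 ^ d) (2 ^ m)) (sym |J|)))
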